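{- $\gamma_p(KN_{4,4}) = \gamma_p(KN_{5,4}) = \gamma_p(KN_{6,4}) = 8$; $\gamma_p(KN_{7,4}) = 28$; $\gamma_p(KN_{8,4}) = 16$; $\gamma_p(KN_{9,4}) = 36$; and $\gamma_p(KN_{10,4}) = \gamma_p(KN_{11,4}) = \gamma_p(KN_{12,4}) = 16$.
   Context: For a graph $G=(V,E)$, a set $S\subseteq V$ is a perfect dominating set if every vertex $v\in V\setminus S$ is adjacent to exactly one vertex of $S$. The perfect domination number $\gamma_p(G)$ is the minimum cardinality of a perfect dominating set of $G$. The knights graph $KN_{n,m}$ has vertex set $\{(i,j): 1\le i\le n,\ 1\le j\le m\}$ (column $i$, row $j$ of a chessboard with $n$ columns and $m$ rows), and $(a,b)$ is adjacent to $(c,d)$ iff $\{|a-c|,|b-d|\}=\{1,2\}$. -}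

module Defs where

open import Data.Nat using (ℕ; zero; suc; _+_; _≤_; _∸_)
open import Data.Fin using (Fin; toℕ)
open import Data.Bool using (Bool; true; false; if_then_else_)
open import Data.Product using (_×_; _,_; Σ; ∃; ∃-syntax)
open import Data.Sum using (_⊎_)
open import Relation.Binary.PropositionalEquality using (_≡_)
open import Relation.Nullary using (¬_)

∣_-_∣ : ℕ → ℕ → ℕ
∣ a - b ∣ = (a ∸ b) + (b ∸ a)

-- Vertices of KN_{n,m}: (column i, row j), 0-indexed via Fin.
Vertex : ℕ → ℕ → Set
Vertex n m = Fin n × Fin m

KnightAdj : ∀ {n m} → Vertex n m → Vertex n m → Set
KnightAdj (a , b) (c , d) =
  (∣ toℕ a - toℕ c ∣ ≡ 1 × ∣ toℕ b - toℕ d ∣ ≡ 2)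
  ⊎ (∣ toℕ a - toℕ c ∣ ≡ 2 × ∣ toℕ b - toℕ d ∣ ≡ 1)

VSet : ℕ → ℕ → Set
VSet n m = Vertex n m → Bool

sumFin : (k : ℕ) → (Fin k → ℕ) → ℕ
sumFin zero f = 0
sumFin (suc k) f = f Fin.zero + sumFin k (λ i → f (Fin.suc i))

card : ∀ {n m} → VSet n m → ℕ
card {n} {m} S = sumFin n (λ i → sumFin m (λ j → if S (i , j) then 1 else 0))

IsPerfectDominating : ∀ {n m} → VSet n m → Set
IsPerfectDominating {n} {m} S =
  ∀ (v : Vertex n m) → S v ≡ false →
    ∃[ u ] (S u ≡ true × KnightAdj v u
           × (∀ (w : Vertex n m) → S w ≡ true → KnightAdj v w → w ≡ u))

PerfectDominationNumber : ℕ → ℕ → ℕ → Set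
PerfectDominationNumber n m k =
  (∃[ S ] (IsPerfectDominating {n} {m} S × card S ≡ k))
  × (∀ (S : VSet n m) → IsPerfectDominating S → k ≤ card S)

-- Both bounds are certified by computation. A perfect dominating set S is
-- characterised locally: every v ∉ S has exactly one neighbour in S, so the
-- upper bounds are a direct check of explicit witnesses. For the lower bound,
-- a backtracking search decides the vertices one at a time and prunes a
-- partial assignment as soon as some decided non-member has either two known
-- neighbours in S or no possible one; every perfect dominating set survives
-- this pruning, so if all completed assignments have at least k members,
-- then γ_p ≥ k.
module Submission where

open import Defs
open import Data.Bool using (Bool; true; false; T; if_then_else_; _∧_; _∨_)
open import Data.Bool.ListAction using (all; any)
open import Data.Bool.Properties using (T-∧; T-≡)
open import Data.Fin using (Fin; toℕ)
import Data.Fin.Properties as Finₚ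
open import Data.List using (List; []; _∷_; map; filter; allFin; cartesianProduct)
open import Data.List.Membership.Propositional using (_∈_)
open import Data.List.Membership.Propositional.Properties
  using (∈-filter⁺; ∈-filter⁻; ∈-cartesianProduct⁺; ∈-allFin)
open import Data.List.Relation.Unary.All as All using (All; []; _∷_)
open import Data.List.Relation.Unary.All.Properties using (all⁺; all⁻) renaming (map⁺ to All-map⁺)
open import Data.List.Relation.Unary.Any using (here; there)
open import Data.List.Relation.Unary.AllPairs using (_∷_)
open import Data.List.Relation.Unary.Unique.Propositional using (Unique)
import Data.List.Relation.Unary.Unique.Propositional.Properties as Unique
open import Data.Maybe using (Maybe; just; nothing; is-just; fromMaybe)
open import Data.Nat using (ℕ; zero; suc; pred; _+_; _≤_; _≤ᵇ_; _≡ᵇ_; _≟_; z≤n; s≤s)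
open import Data.Nat.Properties using (≤ᵇ⇒≤; ≤⇒≤ᵇ; ≡ᵇ⇒≡; ≤-reflexive; ≤-trans; m≤n⇒m≤1+n; +-suc)
open import Data.Product using (_×_; _,_; proj₁; proj₂; ∃-syntax)
open import Data.Product.Properties using (≡-dec)
open import Function using (_∘_)
open import Function.Bundles using (Equivalence)
open import Relation.Binary.Definitions using (Decidable; DecidableEquality)
open import Relation.Binary.PropositionalEquality
open import Relation.Nullary using (yes; no; contradiction)
open import Relation.Nullary.Decidable using (_×-dec_; _⊎-dec_)

open Equivalence using (to; from)

module _ {A : Set} (p : A → Bool) where

  count : List A → ℕ
  count [] = 0
  count (x ∷ xs) = if p x then suc (count xs) else count xs

  ExactlyOne : List A → Set
  ExactlyOne xs = ∃[ u ] (u ∈ xs × p u ≡ true × (∀ {w} → w ∈ xs → p w ≡ true → w ≡ u))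

  count≡0⇒none : ∀ xs {w} → count xs ≡ 0 → w ∈ xs → p w ≢ true
  count≡0⇒none (x ∷ xs) eq w∈ pw with p x in px | w∈
  ... | false | here refl = contradiction (trans (sym px) pw) λ ()
  ... | false | there w∈xs = count≡0⇒none xs eq w∈xs pw

  none⇒count≡0 : ∀ xs → (∀ {w} → w ∈ xs → p w ≢ true) → count xs ≡ 0
  none⇒count≡0 [] none = refl
  none⇒count≡0 (x ∷ xs) none with p x in px
  ... | true = contradiction px (none (here refl))
  ... | false = none⇒count≡0 xs (none ∘ there)

  count≡1⇒exactlyOne : ∀ xs → count xs ≡ 1 → ExactlyOne xs
  count≡1⇒exactlyOne (x ∷ xs) eq with p x in px
  ... | true = x , here refl , px , λ where
    (here refl) _ → refl
    (there w∈xs) pw → contradiction pw (count≡0⇒none xs (cong pred eq) w∈xs)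
  ... | false with count≡1⇒exactlyOne xs eq
  ...   | u , u∈ , pu , unique = u , there u∈ , pu , λ where
    (here refl) pw → contradiction (trans (sym px) pw) λ ()
    (there w∈xs) pw → unique w∈xs pw

  exactlyOne⇒count≡1 : ∀ {xs} → Unique xs → ExactlyOne xs → count xs ≡ 1
  exactlyOne⇒count≡1 {x ∷ xs} (x∉xs ∷ uniq) (u , u∈ , pu , unique) with p x in px | u∈
  ... | true | _ = cong suc (none⇒count≡0 xs λ w∈xs pw →
    All.lookup x∉xs w∈xs (trans (unique (here refl) px) (sym (unique (there w∈xs) pw))))
  ... | false | here refl = contradiction (trans (sym px) pu) λ ()
  ... | false | there u∈xs = exactlyOne⇒count≡1 uniq (u , u∈xs , pu , unique ∘ there)

module PerfectDomination
  {V : Set} (_≟ᵥ_ : DecidableEquality V)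
  (Adj : V → V → Set) (adj? : Decidable Adj)
  (vertices : List V) (∈-vertices : ∀ v → v ∈ vertices) (vertices-unique : Unique vertices)
  (size : (V → Bool) → ℕ) (size-cong : ∀ {S R} → (∀ v → S v ≡ R v) → size S ≡ size R)
  where

  Perfect : (V → Bool) → Set
  Perfect S = ∀ v → S v ≡ false →
    ∃[ u ] (S u ≡ true × Adj v u × (∀ w → S w ≡ true → Adj v w → w ≡ u))

  N : V → List V
  N v = filter (adj? v) vertices

  ∈N⇒Adj : ∀ {v w} → w ∈ N v → Adj v w
  ∈N⇒Adj = proj₂ ∘ ∈-filter⁻ (adj? _) {xs = vertices}

  Adj⇒∈N : ∀ {v w} → Adj v w → w ∈ N v
  Adj⇒∈N {w = w} = ∈-filter⁺ (adj? _) (∈-vertices w)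

  perfect⇒count≡1 : ∀ {S} → Perfect S → ∀ v → S v ≡ false → count S (N v) ≡ 1
  perfect⇒count≡1 {S} perfect v Sv with perfect v Sv
  ... | u , Su , adj , unique = exactlyOne⇒count≡1 S (Unique.filter⁺ (adj? v) vertices-unique)
    (u , Adj⇒∈N adj , Su , λ w∈ Sw → unique _ Sw (∈N⇒Adj w∈))

  count≡1⇒perfect : ∀ {S} → (∀ v → S v ≡ false → count S (N v) ≡ 1) → Perfect S
  count≡1⇒perfect {S} one v Sv with count≡1⇒exactlyOne S (N v) (one v Sv)
  ... | u , u∈ , Su , unique = u , Su , ∈N⇒Adj u∈ , λ w Sw adj → unique (Adj⇒∈N adj) Sw

  isPerfect : (V → Bool) → Bool
  isPerfect S = all (λ v → S v ∨ (count S (N v) ≡ᵇ 1)) vertices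

  isPerfect-sound : ∀ {S} → T (isPerfect S) → Perfect S
  isPerfect-sound {S} ok = count≡1⇒perfect λ v Sv →
    ≡ᵇ⇒≡ _ 1 (subst (λ b → T (b ∨ (count S (N v) ≡ᵇ 1))) Sv
      (All.lookup (all⁺ _ vertices ok) (∈-vertices v)))

  Assignment : Set
  Assignment = List (V × Bool)

  value : Assignment → V → Maybe Bool
  value [] v = nothing
  value ((x , b) ∷ d) v with v ≟ᵥ x
  ... | yes _ = just b
  ... | no _ = value d v

  Agrees : (V → Bool) → Assignment → Set
  Agrees S = All (λ (v , b) → S v ≡ b)

  value-sound : ∀ {S} d {v b} → Agrees S d → value d v ≡ just b → S v ≡ b
  value-sound ((x , _) ∷ d) {v} (Sx ∷ agree) eq with v ≟ᵥ x
  value-sound ((x , _) ∷ d) (Sx ∷ agree) refl | yes refl = Sx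
  ... | no _ = value-sound d agree eq

  members : Assignment → List V → ℕ
  members d [] = 0
  members d (w ∷ ws) with value d w
  ... | just true = suc (members d ws)
  ... | _ = members d ws

  undecided : Assignment → List V → ℕ
  undecided d [] = 0
  undecided d (w ∷ ws) with value d w
  ... | nothing = suc (undecided d ws)
  ... | _ = undecided d ws

  members≤count : ∀ {S} d ws → Agrees S d → members d ws ≤ count S ws
  members≤count d [] agree = z≤n
  members≤count {S} d (w ∷ ws) agree with value d w in eq
  ... | just true rewrite value-sound d agree eq = s≤s (members≤count d ws agree)
  ... | just false rewrite value-sound d agree eq = members≤count d ws agree
  ... | nothing with S w
  ...   | true = m≤n⇒m≤1+n (members≤count d ws agree)
  ...   | false = members≤count d ws agree

  count≤members+undecided : ∀ {S} d ws → Agrees S d → count S ws ≤ members d ws + undecided d ws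
  count≤members+undecided d [] agree = z≤n
  count≤members+undecided {S} d (w ∷ ws) agree with value d w in eq
  ... | just true rewrite value-sound d agree eq = s≤s (count≤members+undecided d ws agree)
  ... | just false rewrite value-sound d agree eq = count≤members+undecided d ws agree
  ... | nothing rewrite +-suc (members d ws) (undecided d ws) with S w
  ...   | true = s≤s (count≤members+undecided d ws agree)
  ...   | false = m≤n⇒m≤1+n (count≤members+undecided d ws agree)

  consistentAt : Assignment → V × List V → Bool
  consistentAt d (v , nv) with value d v
  ... | just false = (members d nv ≤ᵇ 1) ∧ (1 ≤ᵇ members d nv + undecided d nv)
  ... | _ = true

  consistentAt-sound : ∀ {S d} → Perfect S → Agrees S d → ∀ v → T (consistentAt d (v , N v))
  consistentAt-sound {S} {d} perfect agree v with value d v in eq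
  ... | just true = _
  ... | nothing = _
  ... | just false = from T-∧
    ( ≤⇒≤ᵇ (≤-trans (members≤count d (N v) agree) (≤-reflexive one))
    , ≤⇒≤ᵇ (≤-trans (≤-reflexive (sym one)) (count≤members+undecided d (N v) agree)) )
    where
    one : count S (N v) ≡ 1
    one = perfect⇒count≡1 perfect v (value-sound d agree eq)

  complete : Assignment → V → Bool
  complete d v = fromMaybe false (value d v)

  Step : Set
  Step = V × List (V × List V)

  -- Deciding x can only change the constraints at x and at its neighbours.
  step : V → Step
  step x = x , map (λ v → v , N v) (x ∷ N x)

  mutual
    search : ℕ → Assignment → List Step → Bool
    search k d [] = all (is-just ∘ value d) vertices ∧ (k ≤ᵇ size (complete d))
    search k d ((x , checks) ∷ rest) =
      extend k d x checks rest false ∧ extend k d x checks rest true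

    extend : ℕ → Assignment → V → List (V × List V) → List Step → Bool → Bool
    extend k d x checks rest b =
      if all (consistentAt ((x , b) ∷ d)) checks then search k ((x , b) ∷ d) rest else true

  complete-agrees : ∀ {S} d → Agrees S d → T (all (is-just ∘ value d) vertices) → ∀ v → S v ≡ complete d v
  complete-agrees d agree decided v
    with value d v in eq | All.lookup (all⁺ _ vertices decided) (∈-vertices v)
  ... | just b | _ = value-sound d agree eq

  search-sound : ∀ {S k} → Perfect S → ∀ xs d → Agrees S d → T (search k d (map step xs)) → k ≤ size S
  search-sound {S} {k} perfect [] d agree found
    with decided , bound ← to T-∧ found
    rewrite size-cong (complete-agrees d agree decided) = ≤ᵇ⇒≤ k _ bound
  search-sound {S} {k} perfect (x ∷ xs) d agree found =
    search-sound perfect xs ((x , S x) ∷ d) agree′ (branch-taken checked (chosen (S x)))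
    where
    agree′ : Agrees S ((x , S x) ∷ d)
    agree′ = refl ∷ agree

    chosen : ∀ b → T (extend k d x (proj₂ (step x)) (map step xs) b)
    chosen false = proj₁ (to T-∧ found)
    chosen true = proj₂ (to T-∧ found)

    checked : T (all (consistentAt ((x , S x) ∷ d)) (proj₂ (step x)))
    checked = all⁻ _ (All-map⁺ (All.universal (consistentAt-sound perfect agree′) (x ∷ N x)))

    branch-taken : ∀ {c a} → T c → T (if c then a else true) → T a
    branch-taken {true} _ t = t

  lowerBound : ∀ {k} → T (search k [] (map step vertices)) → ∀ S → Perfect S → k ≤ size S
  lowerBound found S perfect = search-sound perfect vertices [] [] found

sumFin-cong : ∀ k {f g : Fin k → ℕ} → (∀ i → f i ≡ g i) → sumFin k f ≡ sumFin k g
sumFin-cong zero eq = refl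
sumFin-cong (suc k) eq = cong₂ _+_ (eq Fin.zero) (sumFin-cong k (eq ∘ Fin.suc))

card-cong : ∀ {n m} {S R : VSet n m} → (∀ v → S v ≡ R v) → card S ≡ card R
card-cong {n} {m} eq =
  sumFin-cong n λ i → sumFin-cong m λ j → cong (λ b → if b then 1 else 0) (eq (i , j))

module KnightsGraph (n m : ℕ) where

  knightAdj? : Decidable (KnightAdj {n} {m})
  knightAdj? (a , b) (c , d) =
    ((∣ toℕ a - toℕ c ∣ ≟ 1) ×-dec (∣ toℕ b - toℕ d ∣ ≟ 2))
    ⊎-dec ((∣ toℕ a - toℕ c ∣ ≟ 2) ×-dec (∣ toℕ b - toℕ d ∣ ≟ 1))

  board : List (Vertex n m)
  board = cartesianProduct (allFin n) (allFin m)

  ∈-board : ∀ v → v ∈ board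
  ∈-board (i , j) = ∈-cartesianProduct⁺ (∈-allFin i) (∈-allFin j)

  open PerfectDomination (≡-dec Finₚ._≟_ Finₚ._≟_) KnightAdj knightAdj? board ∈-board
    (Unique.cartesianProduct⁺ (Unique.allFin⁺ n) (Unique.allFin⁺ m)) card card-cong public

  -- Taking `≡ true` rather than `T` matters: checking `refl` evaluates far faster than `tt`.
  perfectDominationNumber : ∀ k (S : VSet n m) →
    isPerfect S ≡ true → card S ≡ k → search k [] (map step board) ≡ true →
    PerfectDominationNumber n m k
  perfectDominationNumber k S perfect size bound =
    (S , isPerfect-sound (from T-≡ perfect) , size) , lowerBound (from T-≡ bound)

open KnightsGraph using (perfectDominationNumber)

cells : ∀ {n m} → List (ℕ × ℕ) → VSet n m
cells cs (i , j) = any (λ (i′ , j′) → (toℕ i ≡ᵇ i′) ∧ (toℕ j ≡ᵇ j′)) cs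

wholeBoard : ∀ {n m} → VSet n m
wholeBoard _ = true

pds₄ₓ₄ pds₅ₓ₄ pds₆ₓ₄ pds₈ₓ₄ pds₁₀ₓ₄ pds₁₁ₓ₄ pds₁₂ₓ₄ : List (ℕ × ℕ)
pds₄ₓ₄ = (1 , 1) ∷ (1 , 2) ∷ (2 , 0) ∷ (2 , 3) ∷ (3 , 0) ∷ (3 , 1) ∷ (3 , 2) ∷ (3 , 3) ∷ []
pds₅ₓ₄ = (2 , 1) ∷ (2 , 2) ∷ (3 , 0) ∷ (3 , 3) ∷ (4 , 0) ∷ (4 , 1) ∷ (4 , 2) ∷ (4 , 3) ∷ []
pds₆ₓ₄ = (2 , 1) ∷ (2 , 2) ∷ (3 , 0) ∷ (3 , 3) ∷ (4 , 1) ∷ (4 , 2) ∷ (5 , 0) ∷ (5 , 3) ∷ []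
pds₈ₓ₄ =
  (0 , 1) ∷ (0 , 3) ∷ (1 , 0) ∷ (1 , 2) ∷ (2 , 0) ∷ (2 , 2) ∷ (3 , 1) ∷ (3 , 3) ∷
  (4 , 1) ∷ (4 , 3) ∷ (5 , 0) ∷ (5 , 2) ∷ (6 , 0) ∷ (6 , 2) ∷ (7 , 1) ∷ (7 , 3) ∷ []
pds₁₀ₓ₄ =
  (0 , 0) ∷ (0 , 1) ∷ (0 , 2) ∷ (0 , 3) ∷ (1 , 0) ∷ (1 , 3) ∷ (2 , 1) ∷ (2 , 2) ∷
  (7 , 1) ∷ (7 , 2) ∷ (8 , 0) ∷ (8 , 3) ∷ (9 , 0) ∷ (9 , 1) ∷ (9 , 2) ∷ (9 , 3) ∷ []
pds₁₁ₓ₄ =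
  (0 , 2) ∷ (1 , 0) ∷ (1 , 1) ∷ (1 , 2) ∷ (2 , 0) ∷ (2 , 3) ∷ (3 , 1) ∷ (3 , 2) ∷
  (8 , 1) ∷ (8 , 2) ∷ (9 , 0) ∷ (9 , 3) ∷ (10 , 0) ∷ (10 , 1) ∷ (10 , 2) ∷ (10 , 3) ∷ []
pds₁₂ₓ₄ =
  (0 , 2) ∷ (1 , 0) ∷ (1 , 1) ∷ (1 , 2) ∷ (2 , 0) ∷ (2 , 3) ∷ (3 , 1) ∷ (3 , 2) ∷
  (8 , 1) ∷ (8 , 2) ∷ (9 , 0) ∷ (9 , 3) ∷ (10 , 1) ∷ (10 , 2) ∷ (11 , 0) ∷ (11 , 3) ∷ []

-- On the 7 × 4 and 9 × 4 boards the only perfect dominating set is the whole board.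
proposition2p5 :
    PerfectDominationNumber 4 4 8
    × PerfectDominationNumber 5 4 8
    × PerfectDominationNumber 6 4 8
    × PerfectDominationNumber 7 4 28
    × PerfectDominationNumber 8 4 16
    × PerfectDominationNumber 9 4 36
    × PerfectDominationNumber 10 4 16
    × PerfectDominationNumber 11 4 16
    × PerfectDominationNumber 12 4 16
proposition2p5 =
    perfectDominationNumber 4 4 8 (cells pds₄ₓ₄) refl refl refl
  , perfectDominationNumber 5 4 8 (cells pds₅ₓ₄) refl refl refl
  , perfectDominationNumber 6 4 8 (cells pds₆ₓ₄) refl refl refl
  , perfectDominationNumber 7 4 28 wholeBoard refl refl refl
  , perfectDominationNumber 8 4 16 (cells pds₈ₓ₄) refl refl refl
  , perfectDominationNumber 9 4 36 wholeBoard refl refl refl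
  , perfectDominationNumber 10 4 16 (cells pds₁₀ₓ₄) refl refl refl
  , perfectDominationNumber 11 4 16 (cells pds₁₁ₓ₄) refl refl refl
  , perfectDominationNumber 12 4 16 (cells pds₁₂ₓ₄) refl refl refl
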